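{- A column $C$ of type $B$ or of type $D$ is admissible if and only if it can be split.
   Context: $\mathcal B_n=\{1\prec\cdots\prec n\prec0\prec\bar n\prec\cdots\prec\bar1\}$ (total order); $\mathcal D_n=\{1,\dots,n,\bar n,\dots,\bar 1\}$ partially ordered by $1\prec\cdots\prec n-1\prec n\prec\overline{n-1}$, $n-1\prec\bar n\prec\overline{n-1}\prec\cdots\prec\bar1$, with $n,\bar n$ incomparable. $\bar0=0$, $\bar{\bar k}=k$; unbarred means $\preceq n$. A column of type $B$ is a one-column diagram with letters $x_1\preceq\cdots\preceq x_l$ of $\mathcal B_n$ (top to bottom), only $0$ may be repeated; a column of type $D$ has letters $x_1,\dots,x_l$ of $\mathcal D_n$ with $x_{i+1}\not\preceq x_i$ for all $i$. $h(C)=l$, $\mathrm w(C)=x_1\cdots x_l$. $C$ is admissible if $h(C)\le n$ and for all positions $p,q$ with $x_p=z\preceq n$ and $x_q=\bar z$: $|q-p|\ge h(C)-z+1$. Splitting (type $B$): let $I_C=\{z_1\succeq\cdots\succeq z_s\}$ consist of one copy of $0$ per occurrence of $0$ in $C$, followed in decreasing order by the unbarred $z\preceq n$ with both $z,\bar z\in C$. $C$ can be split if there exist unbarred letters $t_1\succ\cdots\succ t_s$ such that $t_1$ is the greatest letter with $t_1\prec z_1$, $t_1\notin C$, $\bar t_1\notin C$, and for $i\ge2$, $t_i$ is the greatest letter with $t_i\prec\min(t_{i-1},z_i)$, $t_i\notin C$, $\bar t_i\notin C$. Type $D$: $\widehat C$ is the column of type $B$ obtained by replacing every factor $\bar n\,n$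 (consecutive) of $\mathrm w(C)$ by $00$; $C$ can be split iff $\widehat C$ can be split. -}

module Defs where

open import Data.Nat using (ℕ; zero; suc; _+_; _∸_; _<_; _≤_; _⊓_; _≡ᵇ_; ∣_-_∣)
import Data.Nat as ℕ
open import Data.Fin using (Fin; toℕ)
import Data.Fin as F
open import Data.Bool using (Bool; true; false; _∧_; if_then_else_)
open import Data.List using (List; []; _∷_; length; lookup; filter; reverse; allFin; replicate; _++_)
open import Data.List.Membership.Propositional using (_∈_)
import Data.List.Membership.DecPropositional as DecMem
open import Data.List.Relation.Unary.Linked using (Linked)
open import Data.Product using (_×_; _,_)
open import Data.Sum using (_⊎_)
open import Relation.Nullary using (¬_; Dec; yes; no)
open import Relation.Nullary.Decidable using (_×-dec_)
open import Relation.Binary.PropositionalEquality using (_≡_; refl; cong)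
open import Relation.Binary.Definitions using (DecidableEquality)

-- Letters.  For k : Fin n, the letter "k" stands for the integer
-- val k = toℕ k + 1 ∈ {1,…,n}.

val : ∀ {n} → Fin n → ℕ
val k = suc (toℕ k)

data BLetter (n : ℕ) : Set where
  ub : Fin n → BLetter n
  zr : BLetter n
  br : Fin n → BLetter n

-- position in the total order of B_n (1 ↦ 1, …, n ↦ n, 0 ↦ n+1, n̄ ↦ n+2, …, 1̄ ↦ 2n+1)
rankB : ∀ {n} → BLetter n → ℕ
rankB (ub k) = val k
rankB {n} zr = suc n
rankB {n} (br k) = (suc n + suc n) ∸ val k

_≺B_ : ∀ {n} → BLetter n → BLetter n → Set
x ≺B y = rankB x < rankB y

data DLetter (n : ℕ) : Set where
  ub : Fin n → DLetter n
  br : Fin n → DLetter n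

-- 1 ↦ 1, …, n ↦ n, n̄ ↦ n, (n-1)‾ ↦ n+1, …, 1̄ ↦ 2n-1
rankD : ∀ {n} → DLetter n → ℕ
rankD (ub k) = val k
rankD {n} (br k) = (n + n) ∸ val k

-- the partial order of D_n: 1 ≺ ⋯ ≺ n-1 ≺ {n, n̄} ≺ (n-1)‾ ≺ ⋯ ≺ 1̄,
-- with n and n̄ incomparable
_≼D_ : ∀ {n} → DLetter n → DLetter n → Set
x ≼D y = x ≡ y ⊎ rankD x < rankD y

-- Columns (listed top to bottom)

IsColumnB : ∀ {n} → List (BLetter n) → Set
IsColumnB = Linked (λ x y → x ≺B y ⊎ (x ≡ zr × y ≡ zr))

IsColumnD : ∀ {n} → List (DLetter n) → Set
IsColumnD = Linked (λ x y → ¬ (y ≼D x))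

-- Admissibility: h(C) ≤ n and for all positions p, q with x_p = z ≼ n
-- and x_q = z̄ :  |q - p| ≥ h(C) - z + 1   (i.e. |q-p| + z ≥ h(C) + 1)

AdmissibleB : ∀ {n} → List (BLetter n) → Set
AdmissibleB {n} C =
  length C ≤ n ×
  (∀ (p q : Fin (length C)) (z : Fin n) →
     lookup C p ≡ ub z → lookup C q ≡ br z →
     suc (length C) ≤ ∣ toℕ q - toℕ p ∣ + val z)

AdmissibleD : ∀ {n} → List (DLetter n) → Set
AdmissibleD {n} C =
  length C ≤ n ×
  (∀ (p q : Fin (length C)) (z : Fin n) →
     lookup C p ≡ ub z → lookup C q ≡ br z →
     suc (length C) ≤ ∣ toℕ q - toℕ p ∣ + val z)

_≟B_ : ∀ {n} → DecidableEquality (BLetter n)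
ub i ≟B ub j with i F.≟ j
... | yes refl = yes refl
... | no ne = no λ { refl → ne refl }
ub _ ≟B zr = no λ ()
ub _ ≟B br _ = no λ ()
zr ≟B ub _ = no λ ()
zr ≟B zr = yes refl
zr ≟B br _ = no λ ()
br _ ≟B ub _ = no λ ()
br _ ≟B zr = no λ ()
br i ≟B br j with i F.≟ j
... | yes refl = yes refl
... | no ne = no λ { refl → ne refl }

_∈B?_ : ∀ {n} (x : BLetter n) (C : List (BLetter n)) → Dec (x ∈ C)
_∈B?_ = DecMem._∈?_ _≟B_

-- The sequence I_C = z₁ ⪰ ⋯ ⪰ z_s, each letter recorded by its rank
-- in B_n (0 ↦ n+1, unbarred z ↦ z): one copy of 0 per occurrence of 0
-- in C, followed in decreasing order by the unbarred z with z, z̄ ∈ C.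
I-C : ∀ {n} → List (BLetter n) → List ℕ
I-C {n} C =
  replicate (length (filter (λ x → x ≟B zr) C)) (suc n) ++
  Data.List.map val (filter (λ z → (ub z ∈B? C) ×-dec (br z ∈B? C)) (reverse (allFin n)))

Free : ∀ {n} → List (BLetter n) → Fin n → Set
Free C t = ¬ (ub t ∈ C) × ¬ (br t ∈ C)

Greatest : ∀ {n} → List (BLetter n) → ℕ → Fin n → Set
Greatest {n} C b t =
  val t < b × Free C t × (∀ (u : Fin n) → val t < val u → val u < b → ¬ Free C u)

-- SplitSeq C b zs : the letters t_i exist for the remaining z's, where
-- b is (the rank of) t_{i-1}  (b = n+1 initially, so that min(b, z₁) = z₁).
data SplitSeq {n : ℕ} (C : List (BLetter n)) : ℕ → List ℕ → Set where
  done : ∀ b → SplitSeq C b []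
  step : ∀ b z zs (t : Fin n) →
         Greatest C (b ⊓ z) t → SplitSeq C (val t) zs → SplitSeq C b (z ∷ zs)

CanSplitB : ∀ {n} → List (BLetter n) → Set
CanSplitB {n} C = SplitSeq C (suc n) (I-C C)

-- Splitting (type D): Ĉ replaces every factor n̄ n of w(C) by 0 0.

isLast : ∀ {n} → Fin n → Bool
isLast {n} k = val k ≡ᵇ n

toB : ∀ {n} → DLetter n → BLetter n
toB (ub k) = ub k
toB (br k) = br k

hat : ∀ {n} → List (DLetter n) → List (BLetter n)
hat [] = []
hat (ub i ∷ xs) = ub i ∷ hat xs
hat (br i ∷ []) = br i ∷ []
hat (br i ∷ br j ∷ xs) = br i ∷ hat (br j ∷ xs)
hat (br i ∷ ub j ∷ xs) =
  if isLast i ∧ isLast j then zr ∷ zr ∷ hat xs else br i ∷ ub j ∷ hat xs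

CanSplitD : ∀ {n} → List (DLetter n) → Set
CanSplitD C = CanSplitB (hat C)

module Submission where

-- Both properties are equivalent to one counting criterion.  For a pair w, w̄ of
-- letters of C, let N_w be the number of letters of C, other than 0, whose absolute
-- value is below w.  A column of type B is strictly increasing apart from its zeros,
-- so the position of a letter is the number of letters of smaller rank; this gives
-- |q − p| = h(C) − N_w − 1 for the positions p, q of w, w̄.  Hence C is admissible
-- iff h(C) ≤ n and N_w < w − 1 for every such pair.
-- On the other side, choosing each t_i greedily succeeds iff Hall's condition holds:
-- for every entry z of I_C, the entries from z onwards are at most as many as the
-- free letters below z.  For the zeros this is h(C) ≤ n.  For z = w, the entries
-- from w onwards are w and the pairs below w, while the free letters below w are
-- the w − 1 absolute values below w minus those occurring in C; since N_w counts the
-- pairs below w together with the absolute values below w occurring in C, the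
-- condition is again N_w < w − 1.
-- For type D, Ĉ is a column of type B with the same pairs at the same positions,
-- except for pairs n, n̄, which satisfy the admissibility inequality once h(C) ≤ n.

import Algebra.Properties.CommutativeMonoid.Sum as CommutativeMonoidSum
open import Data.Bool using (Bool; true; false; _∧_; _∨_; not; if_then_else_)
open import Data.Bool.Properties using (T-≡)
open import Data.Fin as F using (Fin; toℕ; cast)
import Data.Fin.Properties as FP
open import Data.List using (List; []; _∷_; length; lookup; map; filter; reverse; allFin; tabulate; replicate; _∷ʳ_; _++_)
open import Data.List.Properties using (length-map; length-++; length-replicate; map-tabulate; unfold-reverse; reverse-map)
open import Data.List.Membership.Propositional using (_∈_; _∉_)
open import Data.List.Membership.Propositional.Properties using (∈-lookup)
open import Data.List.Relation.Binary.Pointwise using (Pointwise; []; _∷_; Pointwise-length; symmetric; lookup⁺)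
open import Data.List.Relation.Unary.All as All using (All; []; _∷_)
open import Data.List.Relation.Unary.AllPairs using (AllPairs; []; _∷_)
open import Data.List.Relation.Unary.Any using (index)
open import Data.List.Relation.Unary.Any.Properties using (lookup-index)
open import Data.List.Relation.Unary.Linked using ([]; [-]; _∷_)
open import Data.List.Relation.Unary.Linked.Properties using (Linked⇒AllPairs)
open import Data.Nat
  using (ℕ; zero; suc; _+_; _*_; _∸_; _<_; _≤_; _⊓_; _<ᵇ_; _<?_; _≟_; ∣_-_∣; z≤n; s≤s; s≤s⁻¹; z<s)
import Data.Nat.ListAction as List
open import Data.Nat.Properties
open import Data.Nat.Tactic.RingSolver using (solve-∀)
open import Data.Product using (_×_; _,_; ∃; proj₁; proj₂)
open import Data.Product.Function.NonDependent.Propositional using (_×-⇔_)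
open import Data.Sum using (_⊎_; inj₁; inj₂)
open import Data.Unit using (⊤; tt)
open import Function using (_∘_; id; flip)
open import Function.Bundles using (_⇔_; mk⇔; Equivalence)
open import Function.Properties.Equivalence using () renaming (refl to ⇔-refl; sym to ⇔-sym; trans to ⇔-trans)
open import Function.Related.Propositional using (module EquationalReasoning; K-reflexive)
open import Relation.Binary.Definitions using (tri<; tri≈; tri>)
open import Relation.Binary.PropositionalEquality
open import Relation.Nullary using (¬_; does; yes; no; contradiction; ¬?)
open import Relation.Nullary.Decidable using (_×-dec_; dec-true; dec-false)
open import Relation.Unary using (Decidable)

open import Defs

open CommutativeMonoidSum +-0-commutativeMonoid using (sum; sum-cong-≗; ∑-distrib-+; sum-replicate-zero)
open import Algebra.Properties.CommutativeSemigroup +-commutativeSemigroup using (x∙yz≈y∙xz)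

𝟙 : Bool → ℕ
𝟙 b = if b then 1 else 0

if-𝟙-swap : ∀ a b → (if a then 𝟙 b else 0) ≡ (if b then 𝟙 a else 0)
if-𝟙-swap true true = refl
if-𝟙-swap true false = refl
if-𝟙-swap false true = refl
if-𝟙-swap false false = refl

if-0 : ∀ b → (if b then 0 else 0) ≡ 0
if-0 true = refl
if-0 false = refl

𝟙-not∧not+∨ : ∀ a b → 𝟙 (not a ∧ not b) + 𝟙 (a ∨ b) ≡ 1
𝟙-not∧not+∨ true b = refl
𝟙-not∧not+∨ false true = refl
𝟙-not∧not+∨ false false = refl

𝟙+𝟙≡𝟙∧+𝟙∨ : ∀ a b → 𝟙 a + 𝟙 b ≡ 𝟙 (a ∧ b) + 𝟙 (a ∨ b)
𝟙+𝟙≡𝟙∧+𝟙∨ true true = refl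
𝟙+𝟙≡𝟙∧+𝟙∨ true false = refl
𝟙+𝟙≡𝟙∧+𝟙∨ false b = refl

<⇒<ᵇ≡true : ∀ {m n} → m < n → (m <ᵇ n) ≡ true
<⇒<ᵇ≡true {zero} {suc n} _ = refl
<⇒<ᵇ≡true {suc m} {suc n} (s≤s m<n) = <⇒<ᵇ≡true m<n

≥⇒<ᵇ≡false : ∀ {m n} → n ≤ m → (m <ᵇ n) ≡ false
≥⇒<ᵇ≡false {_} {zero} _ = refl
≥⇒<ᵇ≡false {suc m} {suc n} (s≤s n≤m) = ≥⇒<ᵇ≡false n≤m

∸-<ᵇ-reverse : ∀ {k a b} → a ≤ k → b ≤ k → (k ∸ a <ᵇ k ∸ b) ≡ (b <ᵇ a)
∸-<ᵇ-reverse {k} {a} {b} a≤k b≤k with b <? a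
... | yes b<a = trans (<⇒<ᵇ≡true (∸-monoʳ-< b<a a≤k)) (sym (<⇒<ᵇ≡true b<a))
... | no b≮a = trans (≥⇒<ᵇ≡false (∸-monoʳ-≤ k (≮⇒≥ b≮a))) (sym (≥⇒<ᵇ≡false (≮⇒≥ b≮a)))

≤⇔+ʳ-≤ : ∀ {a b} c → a ≤ b ⇔ a + c ≤ b + c
≤⇔+ʳ-≤ c = mk⇔ (+-monoˡ-≤ c) (+-cancelʳ-≤ c _ _)

suc-+-≤⇔ : ∀ d k m → suc (d + suc k) ≤ d + suc m ⇔ suc k ≤ m
suc-+-≤⇔ d k m = mk⇔
  (λ le → s≤s⁻¹ (+-cancelˡ-≤ d _ _ (subst (_≤ d + suc m) (sym (+-suc d (suc k))) le)))
  (λ le → subst (_≤ d + suc m) (+-suc d (suc k)) (+-monoʳ-≤ d (s≤s le)))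

sum-zero : ∀ {n} {f : Fin n → ℕ} → (∀ t → f t ≡ 0) → sum f ≡ 0
sum-zero {n} f≗0 = trans (sum-cong-≗ f≗0) (sum-replicate-zero n)

sum-mono-≤ : ∀ {n} {f g : Fin n → ℕ} → (∀ t → f t ≤ g t) → sum f ≤ sum g
sum-mono-≤ {zero} f≤g = z≤n
sum-mono-≤ {suc n} f≤g = +-mono-≤ (f≤g F.zero) (sum-mono-≤ (f≤g ∘ F.suc))

sum-at : ∀ {n} (k : Fin n) c → sum (λ t → if does (t F.≟ k) then c else 0) ≡ c
sum-at {suc n} F.zero c = trans (cong (c +_) (sum-zero {n} λ _ → refl)) (+-identityʳ c)
sum-at {suc n} (F.suc k) c = sum-at k c

sum-insert : ∀ {n} {f g : Fin n → ℕ} k c → (∀ t → f t ≡ (if does (t F.≟ k) then c else 0) + g t) →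
             sum f ≡ c + sum g
sum-insert {g = g} k c f≗ =
  trans (sum-cong-≗ f≗) (trans (∑-distrib-+ (λ t → if does (t F.≟ k) then c else 0) g) (cong (_+ sum g) (sum-at k c)))

sumBelow : ∀ {n} → ℕ → (Fin n → ℕ) → ℕ
sumBelow m f = sum λ t → if val t <ᵇ m then f t else 0

sumAbove : ∀ {n} → Fin n → (Fin n → ℕ) → ℕ
sumAbove w f = sum λ t → if val w <ᵇ val t then f t else 0

sumBelow-mono : ∀ {n} {m m′} (f : Fin n → ℕ) → m ≤ m′ → sumBelow m f ≤ sumBelow m′ f
sumBelow-mono {m = m} {m′} f m≤m′ = sum-mono-≤ pointwise
  where
  pointwise : ∀ t → (if val t <ᵇ m then f t else 0) ≤ (if val t <ᵇ m′ then f t else 0)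
  pointwise t with val t <? m
  ... | yes t<m rewrite <⇒<ᵇ≡true t<m | <⇒<ᵇ≡true (<-≤-trans t<m m≤m′) = ≤-refl
  ... | no t≮m rewrite ≥⇒<ᵇ≡false (≮⇒≥ t≮m) = z≤n

sumBelow-distrib-+ : ∀ {n} m (f g : Fin n → ℕ) → sumBelow m (λ t → f t + g t) ≡ sumBelow m f + sumBelow m g
sumBelow-distrib-+ m f g = trans (sum-cong-≗ pointwise) (∑-distrib-+ (below f) (below g))
  where
  below : (Fin _ → ℕ) → Fin _ → ℕ
  below h t = if val t <ᵇ m then h t else 0
  pointwise : ∀ t → below (λ t → f t + g t) t ≡ below f t + below g t
  pointwise t with val t <ᵇ m
  ... | true = refl
  ... | false = refl

sumBelow-empty : ∀ {n} (f : Fin n → ℕ) → sumBelow 1 f ≡ 0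
sumBelow-empty {n} f = sum-zero {n} {λ t → if val t <ᵇ 1 then f t else 0} λ _ → refl

sumBelow-all : ∀ {n} (f : Fin n → ℕ) → sumBelow (suc n) f ≡ sum f
sumBelow-all f = sum-cong-≗ λ t → cong (λ b → if b then f t else 0) (<⇒<ᵇ≡true (s≤s (FP.toℕ<n t)))

sumBelow-ones : ∀ {n} k → k ≤ n → sumBelow {n} (suc k) (λ _ → 1) ≡ k
sumBelow-ones {n} zero _ = sum-zero {n} λ _ → refl
sumBelow-ones {suc n} (suc k) (s≤s k≤n) = cong suc (sumBelow-ones k k≤n)

sum-trichotomy : ∀ {n} (w : Fin n) (f : Fin n → ℕ) → sum f ≡ sumBelow (val w) f + (f w + sumAbove w f)
sum-trichotomy w f =
  trans (sum-cong-≗ pointwise)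
    (trans (∑-distrib-+ below (λ t → at t + above t))
      (cong (sumBelow (val w) f +_) (trans (∑-distrib-+ at above) (cong (_+ sumAbove w f) (sum-at w (f w))))))
  where
  below at above : _ → ℕ
  below t = if val t <ᵇ val w then f t else 0
  at t = if does (t F.≟ w) then f w else 0
  above t = if val w <ᵇ val t then f t else 0
  pointwise : ∀ t → f t ≡ below t + (at t + above t)
  pointwise t with <-cmp (toℕ t) (toℕ w)
  ... | tri< t<w _ _ rewrite <⇒<ᵇ≡true (s≤s t<w) | dec-false (t F.≟ w) (<⇒≢ t<w ∘ cong toℕ)
        | ≥⇒<ᵇ≡false (<⇒≤ (s≤s t<w)) = sym (+-identityʳ (f t))
  ... | tri> _ _ w<t rewrite <⇒<ᵇ≡true (s≤s w<t) | dec-false (t F.≟ w) (>⇒≢ w<t ∘ cong toℕ)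
        | ≥⇒<ᵇ≡false (<⇒≤ (s≤s w<t)) = refl
  ... | tri≈ _ t≡w _ rewrite FP.toℕ-injective t≡w | dec-true (w F.≟ w) refl
        | ≥⇒<ᵇ≡false (≤-refl {val w}) = sym (+-identityʳ (f w))

Suffixwise : ∀ {A : Set} → (A → List A → Set) → List A → Set
Suffixwise R [] = ⊤
Suffixwise R (x ∷ xs) = R x xs × Suffixwise R xs

module _ {A : Set} where

  Suffixwise-⇔ : ∀ {R R′ : A → List A → Set} → (∀ x xs → R x xs ⇔ R′ x xs) →
                 ∀ xs → Suffixwise R xs ⇔ Suffixwise R′ xs
  Suffixwise-⇔ R⇔R′ [] = mk⇔ (λ _ → tt) (λ _ → tt)
  Suffixwise-⇔ R⇔R′ (x ∷ xs) = mk⇔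
    (λ (r , rs) → Equivalence.to (R⇔R′ x xs) r , Equivalence.to (Suffixwise-⇔ R⇔R′ xs) rs)
    (λ (r , rs) → Equivalence.from (R⇔R′ x xs) r , Equivalence.from (Suffixwise-⇔ R⇔R′ xs) rs)

  Suffixwise-map : ∀ {B : Set} (f : A → B) {R : B → List B → Set} xs →
                   Suffixwise R (map f xs) ⇔ Suffixwise (λ x xs → R (f x) (map f xs)) xs
  Suffixwise-map f [] = mk⇔ (λ _ → tt) (λ _ → tt)
  Suffixwise-map f (x ∷ xs) = mk⇔
    (λ (r , rs) → r , Equivalence.to (Suffixwise-map f xs) rs)
    (λ (r , rs) → r , Equivalence.from (Suffixwise-map f xs) rs)

  Suffixwise-∷ʳ : ∀ {R : A → List A → Set} xs y →
                  Suffixwise R (xs ∷ʳ y) ⇔ (Suffixwise (λ x xs → R x (xs ∷ʳ y)) xs × R y [])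
  Suffixwise-∷ʳ [] y = mk⇔ (λ (r , _) → tt , r) (λ (_ , r) → r , tt)
  Suffixwise-∷ʳ (x ∷ xs) y = mk⇔
    (λ (r , rs) → let (rs′ , ry) = Equivalence.to (Suffixwise-∷ʳ xs y) rs in (r , rs′) , ry)
    (λ ((r , rs′) , ry) → r , Equivalence.from (Suffixwise-∷ʳ xs y) (rs′ , ry))

  Suffixwise-++⁻ʳ : ∀ {R : A → List A → Set} xs {ys} → Suffixwise R (xs ++ ys) → Suffixwise R ys
  Suffixwise-++⁻ʳ [] rs = rs
  Suffixwise-++⁻ʳ (x ∷ xs) (_ , rs) = Suffixwise-++⁻ʳ xs rs

  Suffixwise-filter : ∀ {P : A → Set} (P? : Decidable P) {R : A → List A → Set} xs →
                      Suffixwise R (filter P? xs) ⇔ Suffixwise (λ x xs → P x → R x (filter P? xs)) xs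
  Suffixwise-filter P? [] = mk⇔ (λ _ → tt) (λ _ → tt)
  Suffixwise-filter P? (x ∷ xs) with P? x
  ... | yes px = mk⇔
    (λ (r , rs) → (λ _ → r) , Equivalence.to (Suffixwise-filter P? xs) rs)
    (λ (r , rs) → r px , Equivalence.from (Suffixwise-filter P? xs) rs)
  ... | no ¬px = mk⇔
    (λ rs → (λ px → contradiction px ¬px) , Equivalence.to (Suffixwise-filter P? xs) rs)
    (λ (_ , rs) → Equivalence.from (Suffixwise-filter P? xs) rs)

reverse-allFin-suc : ∀ n → reverse (allFin (suc n)) ≡ map F.suc (reverse (allFin n)) ∷ʳ F.zero
reverse-allFin-suc n = trans (unfold-reverse F.zero (tabulate F.suc))
  (cong (_∷ʳ F.zero) (trans (cong reverse (sym (map-tabulate id F.suc))) (sym (reverse-map F.suc (allFin n)))))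

length-filter-map-suc-∷ʳ : ∀ {n} {P : Fin (suc n) → Set} (P? : Decidable P) xs →
                           length (filter P? (map F.suc xs ∷ʳ F.zero)) ≡
                           length (filter (P? ∘ F.suc) xs) + 𝟙 (does (P? F.zero))
length-filter-map-suc-∷ʳ P? [] with does (P? F.zero)
... | true = refl
... | false = refl
length-filter-map-suc-∷ʳ P? (x ∷ xs) with does (P? (F.suc x))
... | true = cong suc (length-filter-map-suc-∷ʳ P? xs)
... | false = length-filter-map-suc-∷ʳ P? xs

length-filter-descending : ∀ {n} {P : Fin n → Set} (P? : Decidable P) →
                           length (filter P? (reverse (allFin n))) ≡ sum (λ t → 𝟙 (does (P? t)))
length-filter-descending {zero} P? = refl
length-filter-descending {suc n} P? rewrite reverse-allFin-suc n =
  trans (length-filter-map-suc-∷ʳ P? (reverse (allFin n)))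
    (trans (cong (_+ 𝟙 (does (P? F.zero))) (length-filter-descending (P? ∘ F.suc)))
      (+-comm (sum (λ t → 𝟙 (does (P? (F.suc t))))) (𝟙 (does (P? F.zero)))))

Suffixwise-descending : ∀ {n} {P : Fin n → Set} (P? : Decidable P) (Q : Fin n → ℕ → Set) →
  Suffixwise (λ x xs → Q x (length (filter P? xs))) (reverse (allFin n)) ⇔
  (∀ w → Q w (sumBelow (val w) (λ t → 𝟙 (does (P? t)))))
Suffixwise-descending {zero} P? Q = mk⇔ (λ _ ()) (λ _ → tt)
Suffixwise-descending {suc n} P? Q rewrite reverse-allFin-suc n = begin
  Suffixwise R (map F.suc S ∷ʳ F.zero)
    ∼⟨ Suffixwise-∷ʳ (map F.suc S) F.zero ⟩
  (Suffixwise (λ x xs → R x (xs ∷ʳ F.zero)) (map F.suc S) × Q F.zero 0)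
    ∼⟨ Suffixwise-map F.suc S ×-⇔ ⇔-refl ⟩
  (Suffixwise (λ x xs → R (F.suc x) (map F.suc xs ∷ʳ F.zero)) S × Q F.zero 0)
    ∼⟨ Suffixwise-⇔ (λ x xs → K-reflexive (cong (Q (F.suc x)) (length-filter-map-suc-∷ʳ P? xs))) S ×-⇔ ⇔-refl ⟩
  (Suffixwise (λ x xs → Q (F.suc x) (length (filter (P? ∘ F.suc) xs) + p₀)) S × Q F.zero 0)
    ∼⟨ Suffixwise-descending (P? ∘ F.suc) (λ w k → Q (F.suc w) (k + p₀)) ×-⇔ ⇔-refl ⟩
  ((∀ w → Q (F.suc w) (sumBelow (val w) (λ t → 𝟙 (does (P? (F.suc t)))) + p₀)) × Q F.zero 0)
    ∼⟨ mk⇔ (λ (qs , q₀) → λ { F.zero → subst (Q F.zero) (sym below-zero) q₀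
                             ; (F.suc w) → subst (Q (F.suc w)) (+-comm _ p₀) (qs w) })
           (λ qs → (λ w → subst (Q (F.suc w)) (+-comm p₀ _) (qs (F.suc w)))
                 , subst (Q F.zero) below-zero (qs F.zero)) ⟩
  (∀ w → Q w (sumBelow (val w) (λ t → 𝟙 (does (P? t))))) ∎
  where
  open EquationalReasoning
  S = reverse (allFin n)
  R = λ x xs → Q x (length (filter P? xs))
  p₀ = 𝟙 (does (P? F.zero))
  below-zero = sumBelow-empty (λ t → 𝟙 (does (P? t)))

-- Greedy splitting and Hall's condition

module _ {n : ℕ} (C : List (BLetter n)) where

  Free? : Decidable (Free C)
  Free? t = ¬? (ub t ∈B? C) ×-dec ¬? (br t ∈B? C)

  freeBelow : ℕ → ℕ
  freeBelow m = sumBelow m λ t → 𝟙 (does (Free? t))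

  Hall : ℕ → List ℕ → Set
  Hall b = Suffixwise λ z zs → suc (length zs) ≤ freeBelow (b ⊓ z)

module _ {n : ℕ} {C : List (BLetter n)} where

  freeBelow-mono : ∀ {m m′} → m ≤ m′ → freeBelow C m ≤ freeBelow C m′
  freeBelow-mono = sumBelow-mono λ t → 𝟙 (does (Free? C t))

  freeBelow-greatest : ∀ {m t} → Greatest C m t → freeBelow C m ≡ suc (freeBelow C (val t))
  freeBelow-greatest {m} {t} (t<m , free-t , maximal) = sum-insert t 1 pointwise
    where
    pointwise : ∀ u → (if val u <ᵇ m then 𝟙 (does (Free? C u)) else 0) ≡
                      (if does (u F.≟ t) then 1 else 0) + (if val u <ᵇ val t then 𝟙 (does (Free? C u)) else 0)
    pointwise u with <-cmp (toℕ u) (toℕ t)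
    ... | tri< u<t _ _ rewrite dec-false (u F.≟ t) (<⇒≢ u<t ∘ cong toℕ) | <⇒<ᵇ≡true (s≤s u<t)
          | <⇒<ᵇ≡true (<-trans (s≤s u<t) t<m) = refl
    ... | tri≈ _ u≡t _ rewrite FP.toℕ-injective u≡t | dec-true (t F.≟ t) refl | <⇒<ᵇ≡true t<m
          | dec-true (Free? C t) free-t | ≥⇒<ᵇ≡false (≤-refl {val t}) = refl
    ... | tri> _ _ t<u rewrite dec-false (u F.≟ t) (>⇒≢ t<u ∘ cong toℕ) | ≥⇒<ᵇ≡false (<⇒≤ (s≤s t<u))
          with val u <? m
    ...   | yes u<m rewrite <⇒<ᵇ≡true u<m | dec-false (Free? C u) (maximal u (s≤s t<u) u<m) = refl
    ...   | no u≮m rewrite ≥⇒<ᵇ≡false (≮⇒≥ u≮m) = refl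

  climb : ∀ {m} k t → m ≤ k + val t → val t < m → Free C t → ∃ (Greatest C m)
  climb {m} k t m≤k+t t<m free-t with FP.any? (λ u → (val t <? val u) ×-dec (val u <? m) ×-dec Free? C u)
  ... | no ∄u = t , t<m , free-t , λ u t<u u<m free-u → ∄u (u , t<u , u<m , free-u)
  ... | yes (u , t<u , u<m , free-u) with k
  ...   | zero = contradiction m≤k+t (<⇒≱ t<m)
  ...   | suc k = climb k u (≤-trans m≤k+t (≤-trans (≤-reflexive (sym (+-suc k (val t)))) (+-monoʳ-≤ k t<u)))
                      u<m free-u

  greatest-exists : ∀ m → 0 < freeBelow C m → ∃ (Greatest C m)
  greatest-exists m pos with FP.any? (λ t → (val t <? m) ×-dec Free? C t)
  ... | yes (t , t<m , free-t) = climb m t (m≤m+n m (val t)) t<m free-t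
  ... | no ∄t = contradiction (sum-zero nothing-free) (>⇒≢ pos)
    where
    nothing-free : ∀ t → (if val t <ᵇ m then 𝟙 (does (Free? C t)) else 0) ≡ 0
    nothing-free t with val t <? m
    ... | yes t<m rewrite <⇒<ᵇ≡true t<m | dec-false (Free? C t) (λ free-t → ∄t (t , t<m , free-t)) = refl
    ... | no t≮m rewrite ≥⇒<ᵇ≡false (≮⇒≥ t≮m) = refl

  Hall-length : ∀ {b} zs → Hall C b zs → length zs ≤ freeBelow C b
  Hall-length [] _ = z≤n
  Hall-length {b} (z ∷ zs) (head , _) = ≤-trans head (freeBelow-mono (m⊓n≤m b z))

  Hall-mono : ∀ {a b} → a ≤ b → ∀ zs → Hall C a zs → Hall C b zs
  Hall-mono a≤b [] _ = tt
  Hall-mono a≤b (z ∷ zs) (head , tail) =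
    ≤-trans head (freeBelow-mono (⊓-monoˡ-≤ z a≤b)) , Hall-mono a≤b zs tail

  Hall-lower : ∀ {a b} → a < b → ∀ zs → length zs ≤ freeBelow C a → Hall C b zs → Hall C a zs
  Hall-lower a<b [] _ _ = tt
  Hall-lower {a} {b} a<b (z ∷ zs) len (head , tail) =
    head′ , Hall-lower a<b zs (≤-trans (n≤1+n _) len) tail
    where
    head′ : suc (length zs) ≤ freeBelow C (a ⊓ z)
    head′ with ≤-total z a
    ... | inj₁ z≤a rewrite m≥n⇒m⊓n≡n z≤a =
      subst (λ x → suc (length zs) ≤ freeBelow C x) (m≥n⇒m⊓n≡n (≤-trans z≤a (<⇒≤ a<b))) head
    ... | inj₂ a≤z rewrite m≤n⇒m⊓n≡m a≤z = len

  SplitSeq⇒Hall : ∀ {b zs} → SplitSeq C b zs → Hall C b zs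
  SplitSeq⇒Hall (done b) = tt
  SplitSeq⇒Hall (step b z zs t greatest split) =
    head , Hall-mono {val t} (≤-trans (<⇒≤ (proj₁ greatest)) (m⊓n≤m b z)) zs (SplitSeq⇒Hall split)
    where
    head : suc (length zs) ≤ freeBelow C (b ⊓ z)
    head rewrite freeBelow-greatest greatest = s≤s (Hall-length {val t} zs (SplitSeq⇒Hall split))

  Hall⇒SplitSeq : ∀ b zs → Hall C b zs → SplitSeq C b zs
  Hall⇒SplitSeq b [] _ = done b
  Hall⇒SplitSeq b (z ∷ zs) (head , tail) with greatest-exists (b ⊓ z) (<-≤-trans z<s head)
  ... | t , greatest = step b z zs t greatest (Hall⇒SplitSeq (val t) zs (Hall-lower t<b zs len tail))
    where
    t<b : val t < b
    t<b = <-≤-trans (proj₁ greatest) (m⊓n≤m b z)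
    len : length zs ≤ freeBelow C (val t)
    len = s≤s⁻¹ (subst (suc (length zs) ≤_) (freeBelow-greatest greatest) head)

  SplitSeq⇔Hall : ∀ {b zs} → SplitSeq C b zs ⇔ Hall C b zs
  SplitSeq⇔Hall {b} {zs} = mk⇔ SplitSeq⇒Hall (Hall⇒SplitSeq b zs)

  Hall-replicate : ∀ b m ys → Hall C b (replicate m b ++ ys) ⇔ (m + length ys ≤ freeBelow C b × Hall C b ys)
  Hall-replicate b m ys = mk⇔
    (λ h → subst (_≤ freeBelow C b) (length-replicate-++ m) (Hall-length {b} (replicate m b ++ ys) h)
         , Suffixwise-++⁻ʳ (replicate m b) h)
    (λ (len , h) → fill m len h)
    where
    length-replicate-++ : ∀ m → length (replicate m b ++ ys) ≡ m + length ys
    length-replicate-++ m = trans (length-++ (replicate m b)) (cong (_+ length ys) (length-replicate m))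
    fill : ∀ m → m + length ys ≤ freeBelow C b → Hall C b ys → Hall C b (replicate m b ++ ys)
    fill zero _ h = h
    fill (suc m) len h = head , fill m (≤-trans (n≤1+n _) len) h
      where
      head : suc (length (replicate m b ++ ys)) ≤ freeBelow C (b ⊓ b)
      head rewrite ⊓-idem b | length-replicate-++ m = len

  Hall-descending : ∀ {P : Fin n → Set} (P? : Decidable P) b →
    Hall C b (map val (filter P? (reverse (allFin n)))) ⇔
    (∀ w → P w → suc (sumBelow (val w) (λ t → 𝟙 (does (P? t)))) ≤ freeBelow C (b ⊓ val w))
  Hall-descending {P} P? b = begin
    Hall C b (map val (filter P? S))
      ∼⟨ Suffixwise-map val (filter P? S) ⟩
    Suffixwise (λ x xs → suc (length (map val xs)) ≤ freeBelow C (b ⊓ val x)) (filter P? S)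
      ∼⟨ Suffixwise-⇔ (λ x xs → K-reflexive (cong (λ k → suc k ≤ freeBelow C (b ⊓ val x)) (length-map val xs)))
                      (filter P? S) ⟩
    Suffixwise (λ x xs → suc (length xs) ≤ freeBelow C (b ⊓ val x)) (filter P? S)
      ∼⟨ Suffixwise-filter P? S ⟩
    Suffixwise (λ x xs → P x → suc (length (filter P? xs)) ≤ freeBelow C (b ⊓ val x)) S
      ∼⟨ Suffixwise-descending P? (λ w k → P w → suc k ≤ freeBelow C (b ⊓ val w)) ⟩
    (∀ w → P w → suc (sumBelow (val w) (λ t → 𝟙 (does (P? t)))) ≤ freeBelow C (b ⊓ val w)) ∎
    where
    open EquationalReasoning
    S = reverse (allFin n)

ub≺zr : ∀ {n} (t : Fin n) → ub t ≺B zr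
ub≺zr t = s≤s (FP.toℕ<n t)

zr≺br : ∀ {n} (t : Fin n) → zr ≺B br t
zr≺br {n} t = begin-strict
  suc n                    <⟨ m<m+n (suc n) (m<n⇒0<n∸m (s≤s (FP.toℕ<n t))) ⟩
  suc n + (suc n ∸ val t)  ≡⟨ +-∸-assoc (suc n) (<⇒≤ (s≤s (FP.toℕ<n t))) ⟨
  (suc n + suc n) ∸ val t  ∎
  where open ≤-Reasoning

ub≺br : ∀ {n} (t w : Fin n) → ub t ≺B br w
ub≺br t w = <-trans (ub≺zr t) (zr≺br w)

br≺br : ∀ {n} {t w : Fin n} → val w < val t → br t ≺B br w
br≺br {n} {t} w<t = ∸-monoʳ-< w<t (≤-trans (<⇒≤ (s≤s (FP.toℕ<n t))) (m≤m+n (suc n) (suc n)))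

br<ᵇbr : ∀ {n} (t w : Fin n) → (rankB (br t) <ᵇ rankB (br w)) ≡ (val w <ᵇ val t)
br<ᵇbr {n} t w = ∸-<ᵇ-reverse (val≤2n t) (val≤2n w)
  where
  val≤2n : ∀ (t : Fin n) → val t ≤ suc n + suc n
  val≤2n t = ≤-trans (<⇒≤ (s≤s (FP.toℕ<n t))) (m≤m+n (suc n) (suc n))

ColumnStep : ∀ {n} → BLetter n → BLetter n → Set
ColumnStep x y = x ≺B y ⊎ (x ≡ zr × y ≡ zr)

step-trans : ∀ {n} {x y z : BLetter n} → ColumnStep x y → ColumnStep y z → ColumnStep x z
step-trans (inj₁ x≺y) (inj₁ y≺z) = inj₁ (<-trans x≺y y≺z)
step-trans (inj₁ x≺y) (inj₂ (refl , refl)) = inj₁ x≺y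
step-trans (inj₂ (refl , refl)) (inj₁ y≺z) = inj₁ y≺z
step-trans (inj₂ (refl , refl)) (inj₂ (_ , refl)) = inj₂ (refl , refl)

step-strictˡ : ∀ {n} {x y : BLetter n} → x ≢ zr → ColumnStep x y → x ≺B y
step-strictˡ _ (inj₁ x≺y) = x≺y
step-strictˡ x≢zr (inj₂ (x≡zr , _)) = contradiction x≡zr x≢zr

step-strictʳ : ∀ {n} {x y : BLetter n} → y ≢ zr → ColumnStep x y → x ≺B y
step-strictʳ _ (inj₁ x≺y) = x≺y
step-strictʳ y≢zr (inj₂ (_ , y≡zr)) = contradiction y≡zr y≢zr

head-∉ : ∀ {n} {x : BLetter n} {xs} → x ≢ zr → All (ColumnStep x) xs → x ∉ xs
head-∉ x≢zr steps x∈xs = <-irrefl refl (step-strictˡ x≢zr (All.lookup steps x∈xs))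

_∈ᵇ_ : ∀ {n} → BLetter n → List (BLetter n) → Bool
x ∈ᵇ C = does (x ∈B? C)

occurs : ∀ {n} → List (BLetter n) → BLetter n → ℕ
occurs C x = 𝟙 (x ∈ᵇ C)

-- The same filter as in I-C, so that the block of zeros of I-C has length zeros C by definition.
zeros : ∀ {n} → List (BLetter n) → ℕ
zeros C = length (filter (_≟B zr) C)

weightAt : ∀ {n} → (BLetter n → ℕ) → List (BLetter n) → Fin n → ℕ
weightAt g C t = (if ub t ∈ᵇ C then g (ub t) else 0) + (if br t ∈ᵇ C then g (br t) else 0)

module _ {n : ℕ} (g : BLetter n → ℕ) where

  weight-∷ub : ∀ k {xs} → All (ColumnStep (ub k)) xs →
               sum (weightAt g (ub k ∷ xs)) ≡ g (ub k) + sum (weightAt g xs)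
  weight-∷ub k {xs} steps = sum-insert k (g (ub k)) pointwise
    where
    pointwise : ∀ t → weightAt g (ub k ∷ xs) t ≡ (if does (t F.≟ k) then g (ub k) else 0) + weightAt g xs t
    pointwise t with t F.≟ k
    ... | yes refl rewrite dec-false (ub t ∈B? xs) (head-∉ (λ ()) steps) = refl
    ... | no _ = refl

  weight-∷br : ∀ k {xs} → All (ColumnStep (br k)) xs →
               sum (weightAt g (br k ∷ xs)) ≡ g (br k) + sum (weightAt g xs)
  weight-∷br k {xs} steps = sum-insert k (g (br k)) pointwise
    where
    pointwise : ∀ t → weightAt g (br k ∷ xs) t ≡ (if does (t F.≟ k) then g (br k) else 0) + weightAt g xs t
    pointwise t with t F.≟ k
    ... | yes refl rewrite dec-false (br t ∈B? xs) (head-∉ (λ ()) steps) =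
      trans (+-comm _ (g (br t))) (cong (g (br t) +_) (sym (+-identityʳ _)))
    ... | no _ = refl

  sum-column : ∀ {C} → AllPairs ColumnStep C → List.sum (map g C) ≡ zeros C * g zr + sum (weightAt g C)
  sum-column [] = sym (sum-zero {n} λ _ → refl)
  sum-column {zr ∷ xs} (_ ∷ steps) =
    trans (cong (g zr +_) (sum-column steps)) (sym (+-assoc (g zr) (zeros xs * g zr) (sum (weightAt g xs))))
  sum-column {ub k ∷ xs} (head ∷ steps) =
    trans (cong (g (ub k) +_) (sum-column steps))
      (trans (x∙yz≈y∙xz (g (ub k)) (zeros xs * g zr) (sum (weightAt g xs)))
        (cong (zeros xs * g zr +_) (sym (weight-∷ub k head))))
  sum-column {br k ∷ xs} (head ∷ steps) =
    trans (cong (g (br k) +_) (sum-column steps))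
      (trans (x∙yz≈y∙xz (g (br k)) (zeros xs * g zr) (sum (weightAt g xs)))
        (cong (zeros xs * g zr +_) (sym (weight-∷br k head))))

sum-map-zero : ∀ {A : Set} {g : A → ℕ} {xs} → All (λ y → g y ≡ 0) xs → List.sum (map g xs) ≡ 0
sum-map-zero [] = refl
sum-map-zero (gy≡0 ∷ rest) rewrite gy≡0 = sum-map-zero rest

sum-map-one : ∀ {A : Set} (xs : List A) → List.sum (map (λ _ → 1) xs) ≡ length xs
sum-map-one [] = refl
sum-map-one (_ ∷ xs) = cong suc (sum-map-one xs)

position-column : ∀ {n} {C : List (BLetter n)} → AllPairs ColumnStep C → (p : Fin (length C)) → lookup C p ≢ zr →
                  toℕ p ≡ List.sum (map (λ y → 𝟙 (rankB y <ᵇ rankB (lookup C p))) C)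
position-column {C = x ∷ xs} (steps ∷ _) F.zero x≢zr rewrite ≥⇒<ᵇ≡false (≤-refl {rankB x}) =
  sym (sum-map-zero (All.map (λ x→y → cong 𝟙 (≥⇒<ᵇ≡false (<⇒≤ (step-strictˡ x≢zr x→y)))) steps))
position-column {C = x ∷ xs} (steps ∷ column) (F.suc p) y≢zr
  rewrite <⇒<ᵇ≡true (step-strictʳ y≢zr (All.lookup steps (∈-lookup p))) = cong suc (position-column column p y≢zr)

lettersBelow : ∀ {n} → List (BLetter n) → Fin n → ℕ
lettersBelow C w = sumBelow (val w) (λ t → occurs C (ub t) + occurs C (br t))

module _ {n : ℕ} {C : List (BLetter n)} (column : AllPairs ColumnStep C) where

  length-column : length C ≡ zeros C + sum (λ t → occurs C (ub t) + occurs C (br t))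
  length-column = begin
    length C                                                 ≡⟨ sum-map-one C ⟨
    List.sum (map (λ _ → 1) C)                               ≡⟨ sum-column (λ _ → 1) column ⟩
    zeros C * 1 + sum (weightAt (λ _ → 1) C)                 ≡⟨ cong (_+ sum (weightAt (λ _ → 1) C)) (*-identityʳ _) ⟩
    zeros C + sum (λ t → occurs C (ub t) + occurs C (br t))  ∎
    where open ≡-Reasoning

  position-ub : ∀ p w → lookup C p ≡ ub w → toℕ p ≡ sumBelow (val w) (λ t → occurs C (ub t))
  position-ub p w at-p = begin
    toℕ p                                     ≡⟨ position-column column p (λ eq → ub≢zr (trans (sym at-p) eq)) ⟩
    List.sum (map g′ C)                       ≡⟨ cong (λ x → List.sum (map (λ y → 𝟙 (rankB y <ᵇ rankB x)) C)) at-p ⟩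
    List.sum (map g C)                        ≡⟨ sum-column g column ⟩
    zeros C * g zr + sum (weightAt g C)       ≡⟨ cong₂ _+_ (trans (cong (zeros C *_) g-zr) (*-zeroʳ (zeros C)))
                                                           (sum-cong-≗ pointwise) ⟩
    sumBelow (val w) (λ t → occurs C (ub t))  ∎
    where
    open ≡-Reasoning
    ub≢zr : ub w ≢ zr
    ub≢zr ()
    g′ g : BLetter n → ℕ
    g′ y = 𝟙 (rankB y <ᵇ rankB (lookup C p))
    g y = 𝟙 (rankB y <ᵇ val w)
    g-zr : g zr ≡ 0
    g-zr = cong 𝟙 (≥⇒<ᵇ≡false (<⇒≤ (ub≺zr w)))
    pointwise : ∀ t → weightAt g C t ≡ (if val t <ᵇ val w then occurs C (ub t) else 0)
    pointwise t rewrite ≥⇒<ᵇ≡false (<⇒≤ (ub≺br w t)) | if-0 (br t ∈ᵇ C) =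
      trans (+-identityʳ _) (if-𝟙-swap (ub t ∈ᵇ C) (val t <ᵇ val w))

  position-br : ∀ q w → lookup C q ≡ br w →
                toℕ q ≡ zeros C + (sum (λ t → occurs C (ub t)) + sumAbove w (λ t → occurs C (br t)))
  position-br q w at-q = begin
    toℕ q                                ≡⟨ position-column column q (λ eq → br≢zr (trans (sym at-q) eq)) ⟩
    List.sum (map g′ C)                  ≡⟨ cong (λ x → List.sum (map (λ y → 𝟙 (rankB y <ᵇ rankB x)) C)) at-q ⟩
    List.sum (map g C)                   ≡⟨ sum-column g column ⟩
    zeros C * g zr + sum (weightAt g C)  ≡⟨ cong₂ _+_ (trans (cong (zeros C *_) g-zr) (*-identityʳ (zeros C)))
                                                      (trans (sum-cong-≗ pointwise) (∑-distrib-+ (λ t → occurs C (ub t)) above)) ⟩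
    zeros C + (sum (λ t → occurs C (ub t)) + sumAbove w (λ t → occurs C (br t))) ∎
    where
    open ≡-Reasoning
    br≢zr : br w ≢ zr
    br≢zr ()
    g′ g : BLetter n → ℕ
    g′ y = 𝟙 (rankB y <ᵇ rankB (lookup C q))
    g y = 𝟙 (rankB y <ᵇ rankB (br w))
    above : Fin n → ℕ
    above t = if val w <ᵇ val t then occurs C (br t) else 0
    g-zr : g zr ≡ 1
    g-zr = cong 𝟙 (<⇒<ᵇ≡true (zr≺br w))
    pointwise : ∀ t → weightAt g C t ≡ occurs C (ub t) + above t
    pointwise t rewrite <⇒<ᵇ≡true (ub≺br t w) | br<ᵇbr t w =
      cong (occurs C (ub t) +_) (if-𝟙-swap (br t ∈ᵇ C) (val w <ᵇ val t))

  pair-gap : ∀ p q w → lookup C p ≡ ub w → lookup C q ≡ br w →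
             ∃ λ gap → toℕ q ≡ toℕ p + gap × length C ≡ gap + suc (lettersBelow C w)
  pair-gap p q w at-p at-q = gap , q≡p+gap , length≡
    where
    u v : Fin n → ℕ
    u t = occurs C (ub t)
    v t = occurs C (br t)
    u< = sumBelow (val w) u
    u> = sumAbove w u
    v< = sumBelow (val w) v
    v> = sumAbove w v
    gap = zeros C + (suc u> + v>)
    sum-u : sum u ≡ u< + suc u>
    sum-u = trans (sum-trichotomy w u) (cong (λ x → u< + (x + u>)) u-w)
      where u-w = cong 𝟙 (dec-true (ub w ∈B? C) (subst (_∈ C) at-p (∈-lookup p)))
    sum-v : sum v ≡ v< + suc v>
    sum-v = trans (sum-trichotomy w v) (cong (λ x → v< + (x + v>)) v-w)
      where v-w = cong 𝟙 (dec-true (br w ∈B? C) (subst (_∈ C) at-q (∈-lookup q)))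
    q≡p+gap : toℕ q ≡ toℕ p + gap
    q≡p+gap = begin
      toℕ q                           ≡⟨ position-br q w at-q ⟩
      zeros C + (sum u + v>)          ≡⟨ cong (λ s → zeros C + (s + v>)) sum-u ⟩
      zeros C + ((u< + suc u>) + v>)  ≡⟨ solve-∀′ (zeros C) u< u> v> ⟩
      u< + gap                        ≡⟨ cong (_+ gap) (position-ub p w at-p) ⟨
      toℕ p + gap                     ∎
      where
      open ≡-Reasoning
      solve-∀′ : ∀ z a b c → z + ((a + suc b) + c) ≡ a + (z + (suc b + c))
      solve-∀′ = solve-∀
    length≡ : length C ≡ gap + suc (lettersBelow C w)
    length≡ = begin
      length C                                   ≡⟨ length-column ⟩
      zeros C + sum (λ t → u t + v t)            ≡⟨ cong (zeros C +_) (∑-distrib-+ u v) ⟩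
      zeros C + (sum u + sum v)                  ≡⟨ cong₂ (λ a b → zeros C + (a + b)) sum-u sum-v ⟩
      zeros C + ((u< + suc u>) + (v< + suc v>))  ≡⟨ solve-∀′ (zeros C) u< u> v< v> ⟩
      gap + suc (u< + v<)                        ≡⟨ cong (λ x → gap + suc x) (sumBelow-distrib-+ (val w) u v) ⟨
      gap + suc (lettersBelow C w)               ∎
      where
      open ≡-Reasoning
      solve-∀′ : ∀ z a b c d → z + ((a + suc b) + (c + suc d)) ≡ (z + (suc b + d)) + suc (a + c)
      solve-∀′ = solve-∀

  admissible-pair⇔ : ∀ p q w → lookup C p ≡ ub w → lookup C q ≡ br w →
                     suc (length C) ≤ ∣ toℕ q - toℕ p ∣ + val w ⇔ suc (lettersBelow C w) ≤ toℕ w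
  admissible-pair⇔ p q w at-p at-q with pair-gap p q w at-p at-q
  ... | gap , q≡p+gap , length≡ =
    subst₂ (λ l d → suc l ≤ d + val w ⇔ suc (lettersBelow C w) ≤ toℕ w) (sym length≡) (sym distance≡)
      (suc-+-≤⇔ gap (lettersBelow C w) (toℕ w))
    where
    distance≡ : ∣ toℕ q - toℕ p ∣ ≡ gap
    distance≡ = begin
      ∣ toℕ q - toℕ p ∣        ≡⟨ cong ∣_- toℕ p ∣ q≡p+gap ⟩
      ∣ toℕ p + gap - toℕ p ∣  ≡⟨ ∣-∣-comm (toℕ p + gap) (toℕ p) ⟩
      ∣ toℕ p - toℕ p + gap ∣  ≡⟨ ∣m-m+n∣≡n (toℕ p) gap ⟩
      gap                      ∎
      where open ≡-Reasoning

-- The counting criterion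

CountingCriterion : ∀ {n} → List (BLetter n) → Set
CountingCriterion {n} C = length C ≤ n × (∀ w → ub w ∈ C → br w ∈ C → suc (lettersBelow C w) ≤ toℕ w)

admissibleB⇔criterion : ∀ {n} {C : List (BLetter n)} → AllPairs ColumnStep C → AdmissibleB C ⇔ CountingCriterion C
admissibleB⇔criterion {C = C} column = mk⇔
  (λ (len , adm) → len , λ w ub∈ br∈ →
    let at-p = sym (lookup-index ub∈)
        at-q = sym (lookup-index br∈)
    in Equivalence.to (admissible-pair⇔ column (index ub∈) (index br∈) w at-p at-q) (adm _ _ w at-p at-q))
  (λ (len , crit) → len , λ p q w at-p at-q →
    Equivalence.from (admissible-pair⇔ column p q w at-p at-q)
      (crit w (subst (_∈ C) at-p (∈-lookup p)) (subst (_∈ C) at-q (∈-lookup q))))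

module _ {n : ℕ} {C : List (BLetter n)} where

  private
    Both? : Decidable (λ z → ub z ∈ C × br z ∈ C)
    Both? z = (ub z ∈B? C) ×-dec (br z ∈B? C)

    both either : Fin n → ℕ
    both t = 𝟙 (ub t ∈ᵇ C ∧ br t ∈ᵇ C)
    either t = 𝟙 (ub t ∈ᵇ C ∨ br t ∈ᵇ C)

    ys : List ℕ
    ys = map val (filter Both? (reverse (allFin n)))

  freeBelow+either : ∀ m → freeBelow C m + sumBelow m either ≡ sumBelow {n} m (λ _ → 1)
  freeBelow+either m = trans (sym (sumBelow-distrib-+ m (λ t → 𝟙 (does (Free? C t))) either)) (sum-cong-≗ pointwise)
    where
    pointwise : ∀ t → (if val t <ᵇ m then 𝟙 (does (Free? C t)) + either t else 0) ≡ (if val t <ᵇ m then 1 else 0)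
    pointwise t = cong (λ x → if val t <ᵇ m then x else 0) (𝟙-not∧not+∨ (ub t ∈ᵇ C) (br t ∈ᵇ C))

  lettersBelow-both+either : ∀ w → lettersBelow C w ≡ sumBelow (val w) both + sumBelow (val w) either
  lettersBelow-both+either w = trans (sum-cong-≗ pointwise) (sumBelow-distrib-+ (val w) both either)
    where
    pointwise : ∀ t → (if val t <ᵇ val w then occurs C (ub t) + occurs C (br t) else 0) ≡
                      (if val t <ᵇ val w then both t + either t else 0)
    pointwise t = cong (λ x → if val t <ᵇ val w then x else 0) (𝟙+𝟙≡𝟙∧+𝟙∨ (ub t ∈ᵇ C) (br t ∈ᵇ C))

  Hall-at⇔ : ∀ w → suc (sumBelow (val w) both) ≤ freeBelow C (suc n ⊓ val w) ⇔ suc (lettersBelow C w) ≤ toℕ w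
  Hall-at⇔ w rewrite m≥n⇒m⊓n≡n {n} {toℕ w} (<⇒≤ (FP.toℕ<n w)) =
    subst₂ (λ a b → suc (sumBelow (val w) both) ≤ freeBelow C (val w) ⇔ suc a ≤ b)
      (sym (lettersBelow-both+either w)) (trans (freeBelow+either (val w)) (sumBelow-ones (toℕ w) (<⇒≤ (FP.toℕ<n w))))
      (≤⇔+ʳ-≤ (sumBelow (val w) either))

  Hall-zeros⇔ : AllPairs ColumnStep C → zeros C + length ys ≤ freeBelow C (suc n) ⇔ length C ≤ n
  Hall-zeros⇔ column =
    subst₂ (λ a b → zeros C + length ys ≤ freeBelow C (suc n) ⇔ a ≤ b) length≡ n≡
      (≤⇔+ʳ-≤ (sumBelow (suc n) either))
    where
    both+either : ∀ t → occurs C (ub t) + occurs C (br t) ≡ both t + either t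
    both+either t = 𝟙+𝟙≡𝟙∧+𝟙∨ (ub t ∈ᵇ C) (br t ∈ᵇ C)
    length-ys : length ys ≡ sum both
    length-ys = trans (length-map val (filter Both? (reverse (allFin n)))) (length-filter-descending Both?)
    n≡ : freeBelow C (suc n) + sumBelow (suc n) either ≡ n
    n≡ = trans (freeBelow+either (suc n)) (sumBelow-ones n ≤-refl)
    length≡ : zeros C + length ys + sumBelow (suc n) either ≡ length C
    length≡ = begin
      zeros C + length ys + sumBelow (suc n) either            ≡⟨ cong₂ (λ a b → zeros C + a + b) length-ys (sumBelow-all either) ⟩
      zeros C + sum both + sum either                          ≡⟨ +-assoc (zeros C) (sum both) (sum either) ⟩
      zeros C + (sum both + sum either)                        ≡⟨ cong (zeros C +_) (∑-distrib-+ both either) ⟨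
      zeros C + sum (λ t → both t + either t)                  ≡⟨ cong (zeros C +_) (sum-cong-≗ both+either) ⟨
      zeros C + sum (λ t → occurs C (ub t) + occurs C (br t))  ≡⟨ length-column column ⟨
      length C                                                 ∎
      where open ≡-Reasoning

  canSplitB⇔criterion : AllPairs ColumnStep C → CanSplitB C ⇔ CountingCriterion C
  canSplitB⇔criterion column = begin
    CanSplitB C
      ∼⟨ SplitSeq⇔Hall {C = C} ⟩
    Hall C (suc n) (replicate (zeros C) (suc n) ++ ys)
      ∼⟨ Hall-replicate {C = C} (suc n) (zeros C) ys ⟩
    (zeros C + length ys ≤ freeBelow C (suc n) × Hall C (suc n) ys)
      ∼⟨ Hall-zeros⇔ column ×-⇔ Hall-descending {C = C} Both? (suc n) ⟩
    (length C ≤ n × (∀ w → ub w ∈ C × br w ∈ C → suc (sumBelow (val w) both) ≤ freeBelow C (suc n ⊓ val w)))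
      ∼⟨ ⇔-refl ×-⇔ mk⇔ (λ h w ub∈ br∈ → Equivalence.to (Hall-at⇔ w) (h w (ub∈ , br∈)))
                         (λ h w (ub∈ , br∈) → Equivalence.from (Hall-at⇔ w) (h w ub∈ br∈)) ⟩
    CountingCriterion C ∎
    where open EquationalReasoning

admissibleB⇔canSplitB : ∀ n (C : List (BLetter n)) → IsColumnB C → AdmissibleB C ⇔ CanSplitB C
admissibleB⇔canSplitB n C column = ⇔-trans (admissibleB⇔criterion steps) (⇔-sym (canSplitB⇔criterion steps))
  where steps = Linked⇒AllPairs step-trans column

-- Columns of type D

module _ {n : ℕ} where

  StepD : DLetter n → DLetter n → Set
  StepD x y = ¬ (y ≼D x)

  val≤n : ∀ (k : Fin n) → val k ≤ n
  val≤n = FP.toℕ<n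

  val-injective : ∀ {i j : Fin n} → val i ≡ val j → i ≡ j
  val-injective = FP.toℕ-injective ∘ suc-injective

  n+n∸a≤n⇒a≡n : ∀ {a} → a ≤ n → (n + n) ∸ a ≤ n → a ≡ n
  n+n∸a≤n⇒a≡n {a} a≤n le = ≤-antisym a≤n (m∸n≡0⇒m≤n (n≤0⇒n≡0 (+-cancelˡ-≤ n _ 0 n+[n∸a]≤n+0)))
    where
    n+[n∸a]≤n+0 : n + (n ∸ a) ≤ n + 0
    n+[n∸a]≤n+0 = subst₂ _≤_ (+-∸-assoc n a≤n) (sym (+-identityʳ n)) le

  stepD-rank : ∀ {x y} → StepD x y → rankD x ≤ rankD y
  stepD-rank ¬y≼x = ≮⇒≥ (¬y≼x ∘ inj₂)

  stepD-≢ : ∀ {x y} → StepD x y → y ≢ x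
  stepD-≢ ¬y≼x = ¬y≼x ∘ inj₁

  stepD-ub-ub : ∀ {i j} → StepD (ub i) (ub j) → val i < val j
  stepD-ub-ub ¬j≼i = ≤∧≢⇒< (stepD-rank ¬j≼i) (stepD-≢ ¬j≼i ∘ cong ub ∘ val-injective ∘ sym)

  stepD-br-br : ∀ {i j} → StepD (br i) (br j) → val j < val i
  stepD-br-br {i} {j} ¬j≼i = ≤∧≢⇒< (≮⇒≥ i≮j) (stepD-≢ ¬j≼i ∘ cong br ∘ val-injective)
    where
    i≮j : ¬ val i < val j
    i≮j i<j = <⇒≱ (∸-monoʳ-< i<j (≤-trans (val≤n j) (m≤m+n n n))) (stepD-rank ¬j≼i)

  stepD-br-ub : ∀ {i j} → StepD (br i) (ub j) → val i ≡ n × val j ≡ n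
  stepD-br-ub {i} {j} ¬j≼i = i≡n , ≤-antisym (val≤n j) (subst (_≤ val j) n+n∸i≡n (stepD-rank ¬j≼i))
    where
    i≡n : val i ≡ n
    i≡n = n+n∸a≤n⇒a≡n (val≤n i) (≤-trans (stepD-rank ¬j≼i) (val≤n j))
    n+n∸i≡n : (n + n) ∸ val i ≡ n
    n+n∸i≡n = trans (cong ((n + n) ∸_) i≡n) (m+n∸n≡m n n)

  stepD-ub : ∀ {i d} → StepD (ub i) d → ub i ≺B toB d
  stepD-ub {d = ub j} ¬j≼i = stepD-ub-ub ¬j≼i
  stepD-ub {i} {br j} _ = ub≺br i j

  stepD-top-ub : ∀ {j d} → val j ≡ n → StepD (ub j) d → zr ≺B toB d
  stepD-top-ub {d = br k} _ _ = zr≺br k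
  stepD-top-ub {j} {ub k} j≡n ¬k≼j = contradiction (subst (_< val k) j≡n (stepD-ub-ub ¬k≼j)) (≤⇒≯ (val≤n k))

  isLast⇒val≡n : ∀ {k : Fin n} → isLast k ≡ true → val k ≡ n
  isLast⇒val≡n {k} last = ≡ᵇ⇒≡ (val k) n (Equivalence.from T-≡ last)

  val≡n⇒isLast : ∀ {k : Fin n} → val k ≡ n → isLast k ≡ true
  val≡n⇒isLast {k} k≡n = Equivalence.to T-≡ (≡⇒≡ᵇ (val k) n k≡n)

  IsTop : DLetter n → Set
  IsTop (ub k) = val k ≡ n
  IsTop (br k) = val k ≡ n

  HatImage : DLetter n → BLetter n → Set
  HatImage d b = b ≡ toB d ⊎ (b ≡ zr × IsTop d)

  hat-pointwise : ∀ C → Pointwise HatImage C (hat C)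
  hat-pointwise [] = []
  hat-pointwise (ub i ∷ ds) = inj₁ refl ∷ hat-pointwise ds
  hat-pointwise (br i ∷ []) = inj₁ refl ∷ []
  hat-pointwise (br i ∷ br j ∷ ds) = inj₁ refl ∷ hat-pointwise (br j ∷ ds)
  hat-pointwise (br i ∷ ub j ∷ ds) with isLast i in last-i | isLast j in last-j
  ... | true | true = inj₂ (refl , isLast⇒val≡n last-i) ∷ inj₂ (refl , isLast⇒val≡n last-j) ∷ hat-pointwise ds
  ... | true | false = inj₁ refl ∷ inj₁ refl ∷ hat-pointwise ds
  ... | false | _ = inj₁ refl ∷ inj₁ refl ∷ hat-pointwise ds

  hat-∷ : ∀ {x} d ds → IsColumnB (hat (d ∷ ds)) → (∀ {y} → HatImage d y → ColumnStep x y) →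
          IsColumnB (x ∷ hat (d ∷ ds))
  hat-∷ d ds column next with hat (d ∷ ds) | hat-pointwise (d ∷ ds) | column
  ... | y ∷ _ | image ∷ _ | column′ = next image ∷ column′

  hat-column : ∀ C → IsColumnD C → IsColumnB (hat C)
  hat-column [] _ = []
  hat-column (ub i ∷ []) _ = [-]
  hat-column (br i ∷ []) _ = [-]
  hat-column (ub i ∷ d ∷ ds) (¬d≼i ∷ column) = hat-∷ d ds (hat-column (d ∷ ds) column) next
    where
    next : ∀ {y} → HatImage d y → ColumnStep (ub i) y
    next (inj₁ refl) = inj₁ (stepD-ub ¬d≼i)
    next (inj₂ (refl , _)) = inj₁ (ub≺zr i)
  hat-column (br i ∷ br j ∷ ds) (¬j≼i ∷ column) = hat-∷ (br j) ds (hat-column (br j ∷ ds) column) next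
    where
    next : ∀ {y} → HatImage (br j) y → ColumnStep (br i) y
    next (inj₁ refl) = inj₁ (br≺br (stepD-br-br ¬j≼i))
    next (inj₂ (refl , j≡n)) = contradiction (subst (_< val i) j≡n (stepD-br-br ¬j≼i)) (≤⇒≯ (val≤n i))
  hat-column (br i ∷ ub j ∷ ds) (¬j≼i ∷ column)
    rewrite val≡n⇒isLast (proj₁ (stepD-br-ub ¬j≼i)) | val≡n⇒isLast (proj₂ (stepD-br-ub ¬j≼i)) =
    inj₂ (refl , refl) ∷ after-top ds column
    where
    after-top : ∀ ds → IsColumnD (ub j ∷ ds) → IsColumnB (zr ∷ hat ds)
    after-top [] _ = [-]
    after-top (d ∷ ds) (¬d≼j ∷ column) = hat-∷ d ds (hat-column (d ∷ ds) column) next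
      where
      next : ∀ {y} → HatImage d y → ColumnStep zr y
      next (inj₁ refl) = inj₁ (stepD-top-ub (proj₂ (stepD-br-ub ¬j≼i)) ¬d≼j)
      next (inj₂ (refl , _)) = inj₂ (refl , refl)

  image-ub : ∀ {d z} → HatImage d (ub z) → d ≡ ub z
  image-ub {ub k} (inj₁ refl) = refl

  image-br : ∀ {d z} → HatImage d (br z) → d ≡ br z
  image-br {br k} (inj₁ refl) = refl

  image-of-ub : ∀ {z b} → val z ≢ n → HatImage (ub z) b → b ≡ ub z
  image-of-ub _ (inj₁ b≡z) = b≡z
  image-of-ub z≢n (inj₂ (_ , z≡n)) = contradiction z≡n z≢n

  image-of-br : ∀ {z b} → val z ≢ n → HatImage (br z) b → b ≡ br z
  image-of-br _ (inj₁ b≡z) = b≡z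
  image-of-br z≢n (inj₂ (_ , z≡n)) = contradiction z≡n z≢n

  pair-bound-cast : ∀ {a b} (p q : Fin a) (p′ q′ : Fin b) (z : Fin n) →
                    a ≡ b → toℕ p ≡ toℕ p′ → toℕ q ≡ toℕ q′ →
                    suc a ≤ ∣ toℕ q - toℕ p ∣ + val z → suc b ≤ ∣ toℕ q′ - toℕ p′ ∣ + val z
  pair-bound-cast p q p′ q′ z a≡b p≡p′ q≡q′ =
    subst₂ (λ l d → suc l ≤ d + val z) a≡b (cong₂ ∣_-_∣ q≡q′ p≡p′)

  top-pair-bound : ∀ (C : List (DLetter n)) p q z → length C ≤ n → val z ≡ n →
                   lookup C p ≡ ub z → lookup C q ≡ br z → suc (length C) ≤ ∣ toℕ q - toℕ p ∣ + val z
  top-pair-bound C p q z len z≡n at-p at-q = +-mono-≤ p≢q (≤-trans len (≤-reflexive (sym z≡n)))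
    where
    ub≢br : ub z ≢ br z
    ub≢br ()
    p≢q : 1 ≤ ∣ toℕ q - toℕ p ∣
    p≢q = n≢0⇒n>0 λ d≡0 →
      ub≢br (trans (sym at-p) (trans (cong (lookup C) (FP.toℕ-injective (sym (∣m-n∣≡0⇒m≡n d≡0)))) at-q))

  module _ (C : List (DLetter n)) where

    private
      images : Pointwise HatImage C (hat C)
      images = hat-pointwise C

      preimages : Pointwise (flip HatImage) (hat C) C
      preimages = symmetric id images

      same-length : length C ≡ length (hat C)
      same-length = Pointwise-length images

    admissibleD⇒admissibleB-hat : AdmissibleD C → AdmissibleB (hat C)
    admissibleD⇒admissibleB-hat (len , adm) = subst (_≤ n) same-length len , λ p′ q′ z at-p′ at-q′ →
      let p = cast (Pointwise-length preimages) p′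
          q = cast (Pointwise-length preimages) q′
      in pair-bound-cast p q p′ q′ z same-length (FP.toℕ-cast _ p′) (FP.toℕ-cast _ q′)
           (adm p q z (image-ub (subst (HatImage (lookup C p)) at-p′ (lookup⁺ preimages p′)))
                      (image-br (subst (HatImage (lookup C q)) at-q′ (lookup⁺ preimages q′))))

    admissibleB-hat⇒admissibleD : AdmissibleB (hat C) → AdmissibleD C
    admissibleB-hat⇒admissibleD (len , adm) = lenC , bound
      where
      lenC = subst (_≤ n) (sym same-length) len
      bound : ∀ p q z → lookup C p ≡ ub z → lookup C q ≡ br z → suc (length C) ≤ ∣ toℕ q - toℕ p ∣ + val z
      bound p q z at-p at-q with val z ≟ n
      ... | yes z≡n = top-pair-bound C p q z lenC z≡n at-p at-q
      ... | no z≢n =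
        let p′ = cast same-length p
            q′ = cast same-length q
        in pair-bound-cast p′ q′ p q z (sym same-length) (FP.toℕ-cast _ p) (FP.toℕ-cast _ q)
             (adm p′ q′ z (image-of-ub z≢n (subst (λ d → HatImage d (lookup (hat C) p′)) at-p (lookup⁺ images p)))
                          (image-of-br z≢n (subst (λ d → HatImage d (lookup (hat C) q′)) at-q (lookup⁺ images q))))

admissibleD⇔canSplitD : ∀ n (C : List (DLetter n)) → IsColumnD C → AdmissibleD C ⇔ CanSplitD C
admissibleD⇔canSplitD n C column =
  ⇔-trans (mk⇔ (admissibleD⇒admissibleB-hat C) (admissibleB-hat⇒admissibleD C))
          (admissibleB⇔canSplitB n (hat C) (hat-column C column))

corollary3p1p11 :
    ((n : ℕ) (C : List (BLetter n)) → IsColumnB C → (AdmissibleB C ⇔ CanSplitB C))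
    × ((n : ℕ) (C : List (DLetter n)) → IsColumnD C → (AdmissibleD C ⇔ CanSplitD C))
corollary3p1p11 = admissibleB⇔canSplitB , admissibleD⇔canSplitD
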